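{- Let $s,t$ be positive integers and let $c$ be a rainbow-free coloring of $\mathbb{Z}_{st}$ with respect to Schur triples. For $0\le i\le t-1$ let $R_i=\{j\in\mathbb{Z}_{st}: j\equiv i \pmod t\}$ and $P_i=\{c(j): j\in R_i\}$. Then $|P_i\setminus P_0|\le 1$ for all $1\le i\le t-1$.
   Context: A coloring of $\mathbb{Z}_n$ is a surjective map $c:\mathbb{Z}_n\to\{1,\dots,r\}$. A Schur triple is $(x_1,x_2,x_3)\in\mathbb{Z}_n^3$ with $x_1+x_2\equiv x_3\pmod n$; it is rainbow under $c$ if $c(x_1),c(x_2),c(x_3)$ are pairwise distinct, and $c$ is rainbow-free if no Schur triple is rainbow. -}

module Defs where

open import Data.Nat using (ℕ; suc; _+_; _%_; NonZero)
open import Data.Fin using (Fin; toℕ; fromℕ<)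
open import Data.Fin.Properties using (any?; _≟_)
open import Data.Fin.Subset using (Subset; inside; outside)
open import Relation.Nullary.Decidable using (_×-dec_)
open import Data.Nat.DivMod using (m%n<n)
open import Data.Product using (∃; _×_; _,_)
open import Data.Vec using (tabulate)
open import Data.Bool using (if_then_else_)
open import Relation.Nullary using (¬_; does)
open import Relation.Binary.PropositionalEquality using (_≡_)
import Data.Nat as ℕ

_⊕[_]_ : ∀ {n} → Fin n → NonZero n → Fin n → Fin n
_⊕[_]_ {n} x nz y = fromℕ< (m%n<n (toℕ x + toℕ y) n ⦃ nz ⦄)

Rainbow : ∀ {n r} → (nz : NonZero n) → (Fin n → Fin r) → Fin n → Fin n → Set
Rainbow nz c x y =
  ¬ (c x ≡ c y) × ¬ (c x ≡ c (x ⊕[ nz ] y)) × ¬ (c y ≡ c (x ⊕[ nz ] y))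

RainbowFree : ∀ {n r} → (nz : NonZero n) → (Fin n → Fin r) → Set
RainbowFree nz c = ∀ x y → ¬ Rainbow nz c x y

Surj : ∀ {n r} → (Fin n → Fin r) → Set
Surj {n} {r} c = ∀ (k : Fin r) → ∃ λ (j : Fin n) → c j ≡ k

P : ∀ {n r} → (t : ℕ) → .⦃ NonZero t ⦄ → (Fin n → Fin r) → ℕ → Subset r
P {n} t c i = tabulate λ k →
  if does (any? {n} (λ j → (toℕ j % t ℕ.≟ i % t) ×-dec (c j ≟ k)))
  then inside else outside

module Submission where

-- Write n = s·t and let k ≠ k' be two colours of
-- P_i that do not occur in P_0.  Pick x, y ≡ i (mod t) with c x = k and
-- c y = k', and put d = x − y in ℤ_n.  Since t ∣ n, d ≡ 0 (mod t), so
-- c d ∈ P_0, hence c d ∉ {k, k'}.  But (y, d, y + d = x) is a Schur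
-- triple with colours k', c d, k — pairwise distinct — contradicting
-- rainbow-freeness.  So P_i ─ P_0 has at most one element.

open import Defs
open import Data.Nat using (ℕ; _*_; _≤_; _<_; NonZero)
open import Data.Nat.Properties using (m*n≢0)
open import Data.Fin using (Fin)
open import Data.Fin.Subset using (_─_; ∣_∣)

open import Data.Nat using (_+_; _∸_; _%_; z≤n) renaming (_≟_ to _≟ℕ_)
open import Data.Nat.Properties
  using (≤-trans; ≤-reflexive; <⇒≤; +-comm; +-assoc; m+[n∸m]≡n)
open import Data.Nat.DivMod
  using (m%n<n; %-distribˡ-+; m%n%n≡m%n; [m+n]%n≡m%n; m<n⇒m%n≡m;
         m∣n⇒o%n%m≡o%m; m*n%n≡0)
open import Data.Nat.Divisibility using (_∣_; n∣m⇒m%n≡0; n∣m*n)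
open import Data.Fin using (toℕ; fromℕ<)
open import Data.Fin.Properties using (toℕ<n; toℕ-fromℕ<; toℕ-injective; any?; _≟_)
open import Data.Fin.Subset using (Subset; inside; outside; _∈_; _∉_)
open import Data.Fin.Subset.Properties
  using (nonempty?; Empty-unique; ∣⊥∣≡0; ∣⁅x⁆∣≡1; x∈⁅y⁆⇔x≡y; p⊆q⇒∣p∣≤∣q∣; drop-there)
open import Data.Vec using (_∷_; tabulate; here; there)
open import Data.Vec.Properties using (lookup∘tabulate; []=⇒lookup; lookup⇒[]=)
open import Data.Product using (∃; _×_; _,_)
import Data.Product as Product
open import Data.Sum using (_⊎_; inj₁; inj₂; [_,_]′)
open import Data.Empty using (⊥-elim)
open import Data.Bool using (if_then_else_)
open import Function using (_∘_)
open import Function.Bundles using (_⇔_; mk⇔; Equivalence)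
open import Relation.Nullary using (Dec; yes; no; does; contradiction)
open import Relation.Nullary.Decidable using (_×-dec_)
open import Level using (0ℓ)
open import Relation.Unary using (Pred; Decidable)
open import Relation.Binary.PropositionalEquality
  using (_≡_; _≢_; refl; sym; trans; cong; subst; module ≡-Reasoning)

open Equivalence using (to; from)

∣p∣≤1 : ∀ {m} (p : Subset m) → (∀ {x y} → x ∈ p → y ∈ p → x ≡ y) → ∣ p ∣ ≤ 1
∣p∣≤1 {m} p unique with nonempty? p
... | yes (x , x∈p) =
  ≤-trans (p⊆q⇒∣p∣≤∣q∣ (λ y∈p → from x∈⁅y⁆⇔x≡y (unique y∈p x∈p)))
          (≤-reflexive (∣⁅x⁆∣≡1 x))
... | no empty = subst (λ q → ∣ q ∣ ≤ 1) (sym (Empty-unique empty))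
                       (≤-trans (≤-reflexive (∣⊥∣≡0 m)) z≤n)

x∈p─q⁻ : ∀ {m} {x : Fin m} (p q : Subset m) → x ∈ p ─ q → x ∈ p × x ∉ q
x∈p─q⁻ (inside ∷ p) (outside ∷ q) here = here , λ ()
x∈p─q⁻ (_ ∷ p) (inside ∷ q) (there x∈p─q) =
  Product.map there (λ x∉q → x∉q ∘ drop-there) (x∈p─q⁻ p q x∈p─q)
x∈p─q⁻ (_ ∷ p) (outside ∷ q) (there x∈p─q) =
  Product.map there (λ x∉q → x∉q ∘ drop-there) (x∈p─q⁻ p q x∈p─q)

decided-inside : ∀ {A : Set} (d : Dec A) → (if does d then inside else outside) ≡ inside ⇔ A
decided-inside (yes a) = mk⇔ (λ _ → a) (λ _ → refl)
decided-inside (no ¬a) = mk⇔ (λ ()) (λ a → contradiction a ¬a)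

∈-tabulate-dec : ∀ {m} {Q : Pred (Fin m) 0ℓ} (Q? : Decidable Q) {k : Fin m} →
                 k ∈ tabulate (λ k → if does (Q? k) then inside else outside) ⇔ Q k
∈-tabulate-dec Q? {k} = mk⇔
  (to (decided-inside (Q? k)) ∘ trans (sym (lookup∘tabulate side k)) ∘ []=⇒lookup)
  (lookup⇒[]= k _ ∘ trans (lookup∘tabulate side k) ∘ from (decided-inside (Q? k)))
  where side = λ k → if does (Q? k) then inside else outside

∈P⇔ : ∀ {n r} (t : ℕ) ⦃ _ : NonZero t ⦄ (c : Fin n → Fin r) (i : ℕ) {k : Fin r} →
      k ∈ P t c i ⇔ (∃ λ j → toℕ j % t ≡ i % t × c j ≡ k)
∈P⇔ {n} t c i = ∈-tabulate-dec (λ k → any? {n} (λ j → (toℕ j % t ≟ℕ i % t) ×-dec (c j ≟ k)))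

-- Arithmetic in ℤ_n; the proof nz that n ≠ 0 is made an instance so
-- that reduction modulo n is available.
module Residues {n : ℕ} (nz : NonZero n) where
  instance
    n≢0 : NonZero n
    n≢0 = nz

  infixl 6 _⊖_
  _⊖_ : Fin n → Fin n → Fin n
  x ⊖ y = fromℕ< (m%n<n (toℕ x + (n ∸ toℕ y)) n)

  y+[n∸y]≡n : ∀ (y : Fin n) → toℕ y + (n ∸ toℕ y) ≡ n
  y+[n∸y]≡n y = m+[n∸m]≡n (<⇒≤ (toℕ<n y))

  ⊕-⊖-cancel : ∀ (x y : Fin n) → y ⊕[ nz ] (x ⊖ y) ≡ x
  ⊕-⊖-cancel x y = toℕ-injective (begin
    toℕ (y ⊕[ nz ] (x ⊖ y))    ≡⟨ toℕ-fromℕ< (m%n<n (Y + toℕ (x ⊖ y)) n) ⟩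
    (Y + toℕ (x ⊖ y)) % n      ≡⟨ cong (λ z → (Y + z) % n) (toℕ-fromℕ< (m%n<n D n)) ⟩
    (Y + D % n) % n            ≡⟨ %-distribˡ-+ Y (D % n) n ⟩
    (Y % n + D % n % n) % n    ≡⟨ cong (λ z → (Y % n + z) % n) (m%n%n≡m%n D n) ⟩
    (Y % n + D % n) % n        ≡⟨ %-distribˡ-+ Y D n ⟨
    (Y + D) % n                ≡⟨ cong (_% n) Y+D≡X+n ⟩
    (X + n) % n                ≡⟨ [m+n]%n≡m%n X n ⟩
    X % n                      ≡⟨ m<n⇒m%n≡m (toℕ<n x) ⟩
    X                          ∎)
    where
    open ≡-Reasoning
    X = toℕ x
    Y = toℕ y
    D = X + (n ∸ Y)
    Y+D≡X+n : Y + D ≡ X + n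
    Y+D≡X+n = begin
      Y + (X + (n ∸ Y))   ≡⟨ +-assoc Y X (n ∸ Y) ⟨
      Y + X + (n ∸ Y)     ≡⟨ cong (_+ (n ∸ Y)) (+-comm Y X) ⟩
      X + Y + (n ∸ Y)     ≡⟨ +-assoc X Y (n ∸ Y) ⟩
      X + (Y + (n ∸ Y))   ≡⟨ cong (X +_) (y+[n∸y]≡n y) ⟩
      X + n               ∎

  ⊖-%-≡0 : ∀ (t : ℕ) ⦃ _ : NonZero t ⦄ → t ∣ n → ∀ (x y : Fin n) →
           toℕ x % t ≡ toℕ y % t → toℕ (x ⊖ y) % t ≡ 0
  ⊖-%-≡0 t t∣n x y x≡y = begin
    toℕ (x ⊖ y) % t            ≡⟨ cong (_% t) (toℕ-fromℕ< (m%n<n (X + R) n)) ⟩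
    (X + R) % n % t            ≡⟨ m∣n⇒o%n%m≡o%m t n (X + R) t∣n ⟩
    (X + R) % t                ≡⟨ %-distribˡ-+ X R t ⟩
    (X % t + R % t) % t        ≡⟨ cong (λ z → (z + R % t) % t) x≡y ⟩
    (Y % t + R % t) % t        ≡⟨ %-distribˡ-+ Y R t ⟨
    (Y + R) % t                ≡⟨ cong (_% t) (y+[n∸y]≡n y) ⟩
    n % t                      ≡⟨ n∣m⇒m%n≡0 n t t∣n ⟩
    0                          ∎
    where
    open ≡-Reasoning
    X = toℕ x
    Y = toℕ y
    R = n ∸ Y

open Residues using (_⊖_; ⊕-⊖-cancel; ⊖-%-≡0)

rainbowFree-middle : ∀ {n r} {nz : NonZero n} {c : Fin n → Fin r} → RainbowFree nz c →
                     ∀ x y → c x ≢ c (x ⊕[ nz ] y) →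
                     c y ≡ c x ⊎ c y ≡ c (x ⊕[ nz ] y)
rainbowFree-middle {nz = nz} {c} rf x y cx≢cx+y with c y ≟ c x | c y ≟ c (x ⊕[ nz ] y)
... | yes cy≡cx | _          = inj₁ cy≡cx
... | no _      | yes cy≡cx+y = inj₂ cy≡cx+y
... | no cy≢cx  | no cy≢cx+y = contradiction (cy≢cx ∘ sym , cx≢cx+y , cy≢cx+y) (rf x y)

-- Otherwise the
-- difference d of two of their witnesses lies in the class of 0, and
-- the Schur triple (y, d, y + d) would be rainbow.
new-colours-coincide : ∀ {n r} (nz : NonZero n) (t : ℕ) ⦃ _ : NonZero t ⦄ → t ∣ n →
                       (c : Fin n → Fin r) → RainbowFree nz c → ∀ i {k k'} →
                       k ∈ P t c i → k ∉ P t c 0 → k' ∈ P t c i → k' ∉ P t c 0 → k ≡ k'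
new-colours-coincide nz t t∣n c rf i {k} {k'} k∈Pᵢ k∉P₀ k'∈Pᵢ k'∉P₀ with k ≟ k'
... | yes k≡k' = k≡k'
... | no k≢k' with to (∈P⇔ t c i) k∈Pᵢ | to (∈P⇔ t c i) k'∈Pᵢ
... | x , x≡i , cx≡k | y , y≡i , cy≡k' =
  ⊥-elim ([ (λ cd≡cy → k'∉P₀ (cd∈P₀ (trans cd≡cy cy≡k')))
          , (λ cd≡cy+d → k∉P₀ (cd∈P₀ (trans cd≡cy+d cy+d≡k)))
          ]′ (rainbowFree-middle {nz = nz} {c} rf y d cy≢cy+d))
  where
  d : Fin _
  d = _⊖_ nz x y
  cd∈P₀ : ∀ {k''} → c d ≡ k'' → k'' ∈ P t c 0
  cd∈P₀ cd≡k'' = from (∈P⇔ t c 0)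
    (d , trans (⊖-%-≡0 nz t t∣n x y (trans x≡i (sym y≡i))) (sym (m*n%n≡0 0 t)) , cd≡k'')
  cy+d≡k : c (y ⊕[ nz ] d) ≡ k
  cy+d≡k = trans (cong c (⊕-⊖-cancel nz x y)) cx≡k
  cy≢cy+d : c y ≢ c (y ⊕[ nz ] d)
  cy≢cy+d cy≡cy+d = k≢k' (trans (sym cy+d≡k) (trans (sym cy≡cy+d) cy≡k'))

lemma8 : (s t r : ℕ) → ⦃ _ : NonZero s ⦄ → ⦃ _ : NonZero t ⦄
    → (c : Fin (s * t) → Fin r)
    → Surj c
    → RainbowFree (m*n≢0 s t) c
    → ∀ (i : ℕ) → 1 ≤ i → i < t
    → ∣ P t c i ─ P t c 0 ∣ ≤ 1
lemma8 s t r c _ rf i _ _ = ∣p∣≤1 (P t c i ─ P t c 0) coincide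
  where
  coincide : ∀ {k k'} → k ∈ P t c i ─ P t c 0 → k' ∈ P t c i ─ P t c 0 → k ≡ k'
  coincide k∈ k'∈ with x∈p─q⁻ (P t c i) (P t c 0) k∈ | x∈p─q⁻ (P t c i) (P t c 0) k'∈
  ... | k∈Pᵢ , k∉P₀ | k'∈Pᵢ , k'∉P₀ =
    new-colours-coincide (m*n≢0 s t) t (n∣m*n s) c rf i k∈Pᵢ k∉P₀ k'∈Pᵢ k'∉P₀
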